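{- Let $G$ be an undirected simple graph, $k$ a positive integer and $\mathit{In}$ an edge set with $G[\mathit{In}]$ connected, such that the instance $(G,\mathit{In},k)$ is trimmed and has no far edges. Then for every edge $e\in\Gamma(\mathit{In})$, the graph returned by $\mathrm{TRIM}(G,\mathit{In}\cup\{e\},k)$ has $|E(G)|$ edges.
   Context: $G[F]$ is the subgraph with edge set $F$ and vertex set the endpoints of $F$; $V_{\mathit{In}}$ is the vertex set of $G[\mathit{In}]$. $\Gamma(\mathit{In})$ is the set of edges sharing an endpoint with some edge of $\mathit{In}$. For a vertex set $X$ and edge $e=\{u,v\}$, $\mathrm{dist}(X,e)$ is the minimum over $w\in\{u,v\}$ of the distance from $w$ to the nearest vertex of $X$. An edge $e$ is unnecessary if $\mathrm{dist}(V_{\mathit{In}},e)\ge k-|\mathit{In}|$; it is far if $\mathrm{dist}(V_{\mathit{In}},e)=k-|\mathit{In}|-1$. The instance is trimmed if $G$ has no unnecessary edges. An edge is mandatory if the connected component of the graph minus that edge containing $V_{\mathit{In}}$ has fewer than $k$ edges. $\mathrm{TRIM}(G,\mathit{In},k)$ removes all unnecessary edges (with respect to $\mathit{In}$) from $G$ (giving $H$), then iteratively adds to $\mathit{In}$ mandatory edges of $H$ incident to $V_{\mathit{In}}$; it returns $H$ and the enlarged $\mathit{In}$. -}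

module Defs where

open import Data.Nat using (ℕ; zero; suc; _+_; _≤_; _<_)
open import Data.Fin using (Fin; toℕ)
open import Data.Fin.Subset using (Subset; _∈_; _∉_; ∣_∣; _∪_; ⁅_⁆; _-_; ⊤)
open import Data.Product using (Σ; ∃; _×_; _,_; proj₁; proj₂)
open import Data.Sum using (_⊎_)
open import Relation.Nullary using (¬_)
open import Relation.Binary.PropositionalEquality using (_≡_)

-- Edge i has endpoints (u , v) with u < v (no loops, canonical orientation),
-- and distinct indices give distinct edges (no multi-edges).
record Graph : Set where
  field
    n m      : ℕ
    ends     : Fin m → Fin n × Fin n
    ordered  : ∀ i → toℕ (proj₁ (ends i)) < toℕ (proj₂ (ends i))
    distinct : ∀ i j → ends i ≡ ends j → i ≡ j

module _ (G : Graph) where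
  open Graph G

  EdgeSet : Set
  EdgeSet = Subset m

  Ends : Fin m → Fin n → Set
  Ends i w = (w ≡ proj₁ (ends i)) ⊎ (w ≡ proj₂ (ends i))

  Adj : EdgeSet → Fin n → Fin n → Set
  Adj S x y = ∃ λ i → i ∈ S ×
    ((x ≡ proj₁ (ends i) × y ≡ proj₂ (ends i)) ⊎ (x ≡ proj₂ (ends i) × y ≡ proj₁ (ends i)))

  data Walk (S : EdgeSet) : Fin n → Fin n → ℕ → Set where
    here : ∀ {x} → Walk S x x zero
    step : ∀ {x y z l} → Adj S x y → Walk S y z l → Walk S x z (suc l)

  V : EdgeSet → Fin n → Set
  V In x = ∃ λ i → i ∈ In × Ends i x

  Connected : EdgeSet → Set
  Connected In = ∀ x y → V In x → V In y → ∃ λ l → Walk In x y l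

  Γ : EdgeSet → Fin m → Set
  Γ In i = ∃ λ j → j ∈ In × ∃ λ w → Ends i w × Ends j w

  DistEq : EdgeSet → (Fin n → Set) → Fin m → ℕ → Set
  DistEq S X i d =
    (∀ x w l → X x → Ends i w → Walk S x w l → d ≤ l) ×
    (∃ λ x → ∃ λ w → X x × Ends i w × Walk S x w d)

  -- unnecessary: dist(V_In, e) ≥ k - |In|, i.e. every walk from V_In to an
  -- endpoint of e has length l with l + |In| ≥ k (vacuous if dist = ∞)
  Unnecessary : EdgeSet → EdgeSet → ℕ → Fin m → Set
  Unnecessary S In k i =
    ∀ x w l → V In x → Ends i w → Walk S x w l → k ≤ l + ∣ In ∣

  -- far: dist(V_In, e) = k - |In| - 1
  Far : EdgeSet → EdgeSet → ℕ → Fin m → Set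
  Far S In k i = ∃ λ d → DistEq S (V In) i d × suc (d + ∣ In ∣) ≡ k

  Trimmed : EdgeSet → EdgeSet → ℕ → Set
  Trimmed S In k = ∀ i → i ∈ S → ¬ Unnecessary S In k i

  NoFar : EdgeSet → EdgeSet → ℕ → Set
  NoFar S In k = ∀ i → i ∈ S → ¬ Far S In k i

  InComp : EdgeSet → EdgeSet → Fin m → Set
  InComp S In g = g ∈ S × ∃ λ x → ∃ λ w → ∃ λ l → V In x × Ends g w × Walk S x w l

  -- f is mandatory in H: the component of H - f containing V_In has < k edges
  Mandatory : EdgeSet → EdgeSet → ℕ → Fin m → Set
  Mandatory H In k f = f ∈ H ×
    (∀ (L : EdgeSet) → (∀ g → g ∈ L → InComp (H - f) In g) → ∣ L ∣ < k)

  Incident : EdgeSet → Fin m → Set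
  Incident In f = ∃ λ w → Ends f w × V In w

  data MandClosure (H : EdgeSet) (k : ℕ) : EdgeSet → EdgeSet → Set where
    done : ∀ {In} →
      (∀ f → f ∉ In → Incident In f → ¬ Mandatory H In k f) →
      MandClosure H k In In
    add  : ∀ {In In'} f → f ∉ In → Incident In f → Mandatory H In k f →
      MandClosure H k (In ∪ ⁅ f ⁆) In' → MandClosure H k In In'

  -- TRIM(G, In, k) returns (H, In'): H = G minus the unnecessary edges
  -- (w.r.t. In, distances in G), In' = In enlarged by mandatory edges of H.
  TRIM : EdgeSet → ℕ → EdgeSet → EdgeSet → Set
  TRIM In k H In' =
    (∀ i → (i ∈ H → ¬ Unnecessary ⊤ In k i) × (¬ Unnecessary ⊤ In k i → i ∈ H)) ×
    MandClosure H k In In'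

-- Adding one edge to In lowers the threshold k − |In| by at most one. So an edge that
-- became unnecessary for In ∪ {e} has every walk from V_In to it of length at least
-- k − |In| − 1, and since it is not unnecessary for In, some such walk has exactly that
-- length: the edge would be far. Hence TRIM(G, In ∪ {e}, k) removes no edge.
module Submission where

open import Defs
open import Data.Nat using (ℕ; _<_; _≤_; suc; z≤n; s≤s; _+_)
open import Data.Nat.Properties
  using (≤-trans; ≤-reflexive; ≤-pred; +-suc; +-comm; +-monoʳ-≤; +-cancelʳ-≤; n≤1+n; ≤∧≢⇒<; _≟_)
open import Data.Fin using (Fin)
open import Data.Fin.Subset using (Subset; ∣_∣; _∪_; ⁅_⁆; ⊤; _∈_; _⊆_; inside; outside)
open import Data.Fin.Subset.Properties using (p⊆p∪q; ∣⁅x⁆∣≡1; ∣⊤∣≡n; ⊆-antisym; ∈⊤)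
open import Data.Vec using ([]; _∷_)
open import Data.Product using (_,_; proj₂)
open import Relation.Binary.PropositionalEquality using (_≡_; sym; trans; cong; subst)
open import Relation.Nullary using (¬_; yes; no; contradiction)

∣p∪q∣≤∣p∣+∣q∣ : ∀ {n} (p q : Subset n) → ∣ p ∪ q ∣ ≤ ∣ p ∣ + ∣ q ∣
∣p∪q∣≤∣p∣+∣q∣ []            []            = z≤n
∣p∪q∣≤∣p∣+∣q∣ (outside ∷ p) (outside ∷ q) = ∣p∪q∣≤∣p∣+∣q∣ p q
∣p∪q∣≤∣p∣+∣q∣ (outside ∷ p) (inside ∷ q)  =
  subst (suc ∣ p ∪ q ∣ ≤_) (sym (+-suc ∣ p ∣ ∣ q ∣)) (s≤s (∣p∪q∣≤∣p∣+∣q∣ p q))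
∣p∪q∣≤∣p∣+∣q∣ (inside ∷ p)  (outside ∷ q) = s≤s (∣p∪q∣≤∣p∣+∣q∣ p q)
∣p∪q∣≤∣p∣+∣q∣ (inside ∷ p)  (inside ∷ q)  =
  s≤s (≤-trans (∣p∪q∣≤∣p∣+∣q∣ p q) (+-monoʳ-≤ ∣ p ∣ (n≤1+n ∣ q ∣)))

∣p∪⁅x⁆∣≤1+∣p∣ : ∀ {n} (p : Subset n) (x : Fin n) → ∣ p ∪ ⁅ x ⁆ ∣ ≤ suc ∣ p ∣
∣p∪⁅x⁆∣≤1+∣p∣ p x = ≤-trans (∣p∪q∣≤∣p∣+∣q∣ p ⁅ x ⁆)
  (≤-reflexive (trans (cong (∣ p ∣ +_) (∣⁅x⁆∣≡1 x)) (+-comm ∣ p ∣ 1)))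

∀∈⇒≡⊤ : ∀ {n} {p : Subset n} → (∀ x → x ∈ p) → p ≡ ⊤
∀∈⇒≡⊤ all∈ = ⊆-antisym (λ _ → ∈⊤) (λ {x} _ → all∈ x)

module _ (G : Graph) where
  V-mono : ∀ {In In′} → In ⊆ In′ → ∀ {x} → V G In x → V G In′ x
  V-mono In⊆In′ (i , i∈In , ends) = i , In⊆In′ i∈In , ends

  unnecessary-walk-bound : ∀ {S In In′ k i} → In ⊆ In′ → ∣ In′ ∣ ≤ suc ∣ In ∣ →
    Unnecessary G S In′ k i →
    ∀ x w l → V G In x → Ends G i w → Walk G S x w l → k ≤ suc (l + ∣ In ∣)
  unnecessary-walk-bound {In = In} {In′} In⊆In′ ∣In′∣≤ U′ x w l x∈V w∈i walk =
    ≤-trans (U′ x w l (V-mono In⊆In′ x∈V) w∈i walk)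
            (≤-trans (+-monoʳ-≤ l ∣In′∣≤) (≤-reflexive (+-suc l ∣ In ∣)))

  unnecessary-superset⇒unnecessary : ∀ {S In In′ k i} → In ⊆ In′ → ∣ In′ ∣ ≤ suc ∣ In ∣ →
    ¬ Far G S In k i → Unnecessary G S In′ k i → Unnecessary G S In k i
  unnecessary-superset⇒unnecessary {In = In} {k = k} {i} In⊆In′ ∣In′∣≤ ¬far U′ x w l x∈V w∈i walk
    with k ≟ suc (l + ∣ In ∣)
  ... | no  k≢ =
    ≤-pred (≤∧≢⇒< (unnecessary-walk-bound In⊆In′ ∣In′∣≤ U′ x w l x∈V w∈i walk) k≢)
  ... | yes k≡ = contradiction (l , (shortest , (x , w , x∈V , w∈i , walk)) , sym k≡) ¬far
    where
    shortest : ∀ x′ w′ l′ → V G In x′ → Ends G i w′ → Walk G _ x′ w′ l′ → l ≤ l′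
    shortest x′ w′ l′ x′∈V w′∈i walk′ = +-cancelʳ-≤ ∣ In ∣ l l′ (≤-pred
      (subst (_≤ suc (l′ + ∣ In ∣)) k≡
        (unnecessary-walk-bound In⊆In′ ∣In′∣≤ U′ x′ w′ l′ x′∈V w′∈i walk′)))

  trimmed-noFar⇒trimmed-∪⁅⁆ : ∀ {S In k} → Trimmed G S In k → NoFar G S In k →
    ∀ e → Trimmed G S (In ∪ ⁅ e ⁆) k
  trimmed-noFar⇒trimmed-∪⁅⁆ {In = In} trimmed noFar e i i∈S U′ =
    trimmed i i∈S (unnecessary-superset⇒unnecessary (p⊆p∪q ⁅ e ⁆) (∣p∪⁅x⁆∣≤1+∣p∣ In e) (noFar i i∈S) U′)

lemma9 : (G : Graph) (k : ℕ) (In : Subset (Graph.m G)) →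
    0 < k → Connected G In → Trimmed G ⊤ In k → NoFar G ⊤ In k →
    (e : Fin (Graph.m G)) → Γ G In e →
    (H In' : Subset (Graph.m G)) → TRIM G (In ∪ ⁅ e ⁆) k H In' →
    ∣ H ∣ ≡ Graph.m G
lemma9 G k In _ _ trimmed noFar e _ H _ (H-spec , _) =
  trans (cong ∣_∣ H≡⊤) (∣⊤∣≡n (Graph.m G))
  where
  H≡⊤ : H ≡ ⊤
  H≡⊤ = ∀∈⇒≡⊤ λ i → proj₂ (H-spec i) (trimmed-noFar⇒trimmed-∪⁅⁆ G trimmed noFar e i ∈⊤)
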